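{- Let $r,n$ be positive integers. For every $(\rho,\epsilon)\in I_{r,n}$ and every $\pi\in S_n$, \[ \mathrm{NNeg}\bigl([(\rho,\epsilon)\pi]^{ -1}\bigr)=\mathrm{NNeg}\bigl((\rho,\epsilon)^{ -1}\bigr) \] as multisets. Moreover, each element $(\rho,\epsilon)\in I_{r,n}$ is uniquely determined (within $I_{r,n}$) by the multiset $\mathrm{NNeg}((\rho,\epsilon)^{ -1})$.
   Context: Let $\omega=e^{2\pi i/r}$. The wreath product $\mathbb{Z}_r\wr S_n$ consists of pairs $(\pi,\epsilon)$ with $\pi\in S_n$ and $\epsilon=(\epsilon_1,\ldots,\epsilon_n)$, $\epsilon_j=\omega^{c_j}$ with $c_j\in\{0,\ldots,r-1\}$ (the color of position $j$). Identify $(\pi,\epsilon)$ with the $n\times n$ matrix whose entry in position $(\pi(i),i)$ is $\epsilon_i$ for each $i$ and all other entries $0$; the group operation (and inverse) is matrix multiplication (inverse). Write $(\pi,\epsilon)$ in window notation as $[\pi(1)^{c_1}\,\pi(2)^{c_2}\cdots\pi(n)^{c_n}]$. A permutation $\pi\in S_n$ is identified with $(\pi,(1,\ldots,1))$; thus the window of $(\rho,\epsilon)\pi$ is $[\rho(\pi(1))^{c_{\pi(1)}}\cdots\rho(\pi(n))^{c_{\pi(n)}}]$. Totally order pairs $j^{c}$ ($j\in[n]$, $c\in\{0,\ldots,r-1\}$) by $j^{c}<k^{d}$ if $c>d$, or if $c=d$ and $j<k$. The type-$A$ descent set of $(\pi,\epsilon)$ is $\mathrm{Des}_A(\pi,\epsilon)=\{i\in[n-1]:\pi(i)^{c_i}>\pi(i+1)^{c_{i+1}}\}$.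 $I_{r,n}$ is the set of $(\rho,\epsilon)\in\mathbb{Z}_r\wr S_n$ with $\mathrm{Des}_A(\rho,\epsilon)=\emptyset$. For $(\sigma,\delta)\in\mathbb{Z}_r\wr S_n$ with colors $d_1,\ldots,d_n$, $\mathrm{NNeg}(\sigma,\delta)$ is the multiset containing each $i\in[n]$ with multiplicity $d_i$. (Equivalently, $\mathrm{NNeg}((\pi,\epsilon)^{ -1})$ contains each $\pi(i)$ with multiplicity $(r-c_i)\bmod r$.) -}

module Defs where

open import Data.Nat using (ℕ; zero; suc; _+_; _∸_; _<_; NonZero)
open import Data.Nat.DivMod using (_mod_)
open import Data.Fin using (Fin; toℕ)
open import Data.Fin.Permutation using (Permutation′; _⟨$⟩ʳ_; _⟨$⟩ˡ_; _∘ₚ_; flip; id)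
open import Data.Product using (_×_; _,_)
open import Data.Sum using (_⊎_)
open import Data.Empty using (⊥)
open import Relation.Binary.PropositionalEquality using (_≡_)

-- An element (π, ε) of the wreath product ℤ_r ≀ S_n.
-- Colors c_j ∈ {0,…,r-1} are stored as Fin r; ε_j = ω^{c_j}.
-- The element corresponds to the monomial matrix with entry ε_i at (π(i), i).
record Col (r n : ℕ) : Set where
  constructor col⟨_,_⟩
  field
    perm  : Permutation′ n
    color : Fin n → Fin r
open Col public

module _ {r : ℕ} .{{_ : NonZero r}} where

  _+ᶜ_ : Fin r → Fin r → Fin r
  a +ᶜ b = (toℕ a + toℕ b) mod r

  -ᶜ_ : Fin r → Fin r
  -ᶜ a = (r ∸ toℕ a) mod r

  zeroᶜ : Fin r
  zeroᶜ = 0 mod r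

  -- Group operation = matrix multiplication of the monomial matrices:
  -- (σ,δ)(π,ε) has entry δ_{π(i)} ε_i at position (σ(π(i)), i).
  _·_ : ∀ {n} → Col r n → Col r n → Col r n
  x · y = col⟨ perm y ∘ₚ perm x , (λ i → color x (perm y ⟨$⟩ʳ i) +ᶜ color y i) ⟩

  -- Inverse = inverse matrix: (π,ε)⁻¹ = (π⁻¹, δ) with δ_{π(i)} = ε_i⁻¹.
  _⁻¹ : ∀ {n} → Col r n → Col r n
  x ⁻¹ = col⟨ flip (perm x) , (λ j → -ᶜ color x (perm x ⟨$⟩ˡ j)) ⟩

  embed : ∀ {n} → Permutation′ n → Col r n
  embed π = col⟨ π , (λ _ → zeroᶜ) ⟩

_<ᵖ_ : ∀ {r n} → (Fin n × Fin r) → (Fin n × Fin r) → Set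
(j , c) <ᵖ (k , d) = (toℕ d < toℕ c) ⊎ ((c ≡ d) × (toℕ j < toℕ k))

entry : ∀ {r n} → Col r n → Fin n → Fin n × Fin r
entry x i = (perm x ⟨$⟩ʳ i , color x i)

-- i ∈ Des_A(x), for positions i, i+1 (0-based: toℕ j ≡ suc (toℕ i)).
IsDescentAt : ∀ {r n} → Col r n → Fin n → Fin n → Set
IsDescentAt x i j = (toℕ j ≡ suc (toℕ i)) × (entry x j <ᵖ entry x i)

InI : ∀ {r n} → Col r n → Set
InI x = ∀ i j → IsDescentAt x i j → ⊥

Multiset : ℕ → Set
Multiset n = Fin n → ℕ

_≡ₘ_ : ∀ {n} → Multiset n → Multiset n → Set
m ≡ₘ m' = ∀ i → m i ≡ m' i

-- NNeg(σ,δ): each i with multiplicity d_i.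
NNeg : ∀ {r n} → Col r n → Multiset n
NNeg x i = toℕ (color x i)

_≈ᶜ_ : ∀ {r n} → Col r n → Col r n → Set
x ≈ᶜ y = (∀ i → perm x ⟨$⟩ʳ i ≡ perm y ⟨$⟩ʳ i) × (∀ i → color x i ≡ color y i)

-- Right multiplication by an uncoloured π only reorders the window of x, whereas NNeg of the
-- inverse records the colour attached to each value, so it does not change.  Conversely,
-- NNeg (x⁻¹) fixes the set of coloured letters π(i)^{c_i} in the window, an element of I_{r,n}
-- lists that set in increasing order, and two strictly increasing sequences with the same set
-- of entries coincide.
module Submission where

open import Defs
open import Data.Nat as ℕ using (ℕ; NonZero; zero; suc; _+_; _∸_; _%_)
import Data.Nat.Properties as ℕ
open import Data.Nat.DivMod using (_mod_; m<n⇒m%n≡m; n%n≡0)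
import Data.Fin as Fin
open import Data.Fin using (Fin; toℕ; inject₁; _<_; _≤_)
open import Data.Fin.Properties
  using (toℕ-injective; toℕ-fromℕ<; toℕ-inject₁; toℕ<n; <-cmp; ≤-antisym; ≤∧≢⇒<; ≤̄⇒inject₁<; _≟_;
         <-isStrictTotalOrder)
open import Data.Fin.Induction using (<-weakInduction; <-weakInduction-startingFrom)
open import Data.Fin.Permutation using (Permutation′; _⟨$⟩ʳ_; _⟨$⟩ˡ_; inverseˡ; inverseʳ)
open import Data.Product using (_×_; _,_; proj₁; proj₂; swap; ∃-syntax)
open import Data.Product.Relation.Binary.Pointwise.NonDependent using (Pointwise)
open import Data.Product.Relation.Binary.Lex.Strict using (×-isStrictTotalOrder)
open import Function.Base using (_∘_; _on_)
open import Level using (0ℓ)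
open import Relation.Binary.Core using (Rel; _Preserves_⟶_)
open import Relation.Binary.Definitions using (tri<; tri≈; tri>)
open import Relation.Binary.Structures using (IsStrictPartialOrder; IsStrictTotalOrder)
import Relation.Binary.Construct.Flip.EqAndOrd as Flip
import Relation.Binary.Construct.On as On
open import Relation.Binary.PropositionalEquality
open import Relation.Nullary using (yes; no; contradiction)

increasing⇒inflationary : ∀ {n} {σ : Fin n → Fin n} → σ Preserves _<_ ⟶ _<_ → ∀ i → i ≤ σ i
increasing⇒inflationary {suc n} {σ} σ↑ = <-weakInduction (λ i → i ≤ σ i) ℕ.z≤n extend
  where
  extend : ∀ k → inject₁ k ≤ σ (inject₁ k) → Fin.suc k ≤ σ (Fin.suc k)
  extend k k≤σk = ℕ.≤-trans (ℕ.s≤s (ℕ.≤-trans (ℕ.≤-reflexive (sym (toℕ-inject₁ k))) k≤σk))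
                            (σ↑ (≤̄⇒inject₁< ℕ.≤-refl))

module _ {a ℓ₁ ℓ₂} {A : Set a} {_≈_ : Rel A ℓ₁} {_≺_ : Rel A ℓ₂}
         (≺-isStrictPartialOrder : IsStrictPartialOrder _≈_ _≺_) where

  open IsStrictPartialOrder ≺-isStrictPartialOrder
    renaming (trans to ≺-trans; irrefl to ≺-irrefl; asym to ≺-asym)

  adjacent⇒increasing : ∀ {n} {F : Fin n → A} →
    (∀ i j → toℕ j ≡ suc (toℕ i) → F i ≺ F j) → F Preserves _<_ ⟶ _≺_
  adjacent⇒increasing {suc n} {F} step {i} i<j =
    <-weakInduction-startingFrom P (λ i<i → contradiction i<i (ℕ.<-irrefl refl)) extend (ℕ.<⇒≤ i<j) i<j
    where
    P : Fin (suc n) → Set ℓ₂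
    P j = i < j → F i ≺ F j

    step-inject₁ : ∀ k → F (inject₁ k) ≺ F (Fin.suc k)
    step-inject₁ k = step (inject₁ k) (Fin.suc k) (cong suc (sym (toℕ-inject₁ k)))

    extend : ∀ k → P (inject₁ k) → P (Fin.suc k)
    extend k ih i<1+k with i ≟ inject₁ k
    ... | yes refl = step-inject₁ k
    ... | no i≢k = ≺-trans (ih (≤∧≢⇒< i≤k i≢k)) (step-inject₁ k)
      where
      i≤k : i ≤ inject₁ k
      i≤k = ℕ.≤-trans (ℕ.s≤s⁻¹ i<1+k) (ℕ.≤-reflexive (sym (toℕ-inject₁ k)))

  increasing⇒injective : ∀ {n} {F : Fin n → A} → F Preserves _<_ ⟶ _≺_ →
    ∀ {i j} → F i ≈ F j → i ≡ j
  increasing⇒injective {F = F} F↑ {i} {j} Fi≈Fj with <-cmp i j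
  ... | tri< i<j _ _ = contradiction (F↑ i<j) (≺-irrefl Fi≈Fj)
  ... | tri≈ _ i≡j _ = i≡j
  ... | tri> _ _ j<i = contradiction (F↑ j<i) (≺-irrefl (Eq.sym Fi≈Fj))

  reindex-increasing : ∀ {n} {F G : Fin n → A} {σ : Fin n → Fin n} →
    F Preserves _<_ ⟶ _≺_ → G Preserves _<_ ⟶ _≺_ → (∀ i → G (σ i) ≈ F i) →
    σ Preserves _<_ ⟶ _<_
  reindex-increasing {F = F} {G} {σ} F↑ G↑ G∘σ≈F {i} {j} i<j with <-cmp (σ i) (σ j)
  ... | tri< σi<σj _ _ = σi<σj
  ... | tri≈ _ σi≡σj _ = contradiction (F↑ i<j) (≺-irrefl Fi≈Fj)
    where
    Fi≈Fj : F i ≈ F j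
    Fi≈Fj = Eq.trans (Eq.sym (G∘σ≈F i)) (Eq.trans (Eq.reflexive (cong G σi≡σj)) (G∘σ≈F j))
  ... | tri> _ _ σj<σi =
    contradiction (<-respʳ-≈ (G∘σ≈F i) (<-respˡ-≈ (G∘σ≈F j) (G↑ σj<σi))) (≺-asym (F↑ i<j))

  increasing-unique : ∀ {n} {F G : Fin n → A} →
    F Preserves _<_ ⟶ _≺_ → G Preserves _<_ ⟶ _≺_ →
    (∀ i → ∃[ j ] G j ≈ F i) → (∀ j → ∃[ i ] F i ≈ G j) → ∀ i → F i ≈ G i
  increasing-unique {n} {F} {G} F↑ G↑ F⊆G G⊆F i =
    subst (λ k → F i ≈ G k) σi≡i (Eq.sym (proj₂ (F⊆G i)))
    where
    -- σ and τ are increasing self-maps, hence inflationary, and τ ∘ σ = id: i ≤ σ i ≤ τ (σ i) = i.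
    σ τ : Fin n → Fin n
    σ k = proj₁ (F⊆G k)
    τ k = proj₁ (G⊆F k)

    τσi≡i : τ (σ i) ≡ i
    τσi≡i = increasing⇒injective F↑ (Eq.trans (proj₂ (G⊆F (σ i))) (proj₂ (F⊆G i)))

    σi≡i : σ i ≡ i
    σi≡i = ≤-antisym
      (subst (σ i ≤_) τσi≡i (increasing⇒inflationary (reindex-increasing G↑ F↑ (proj₂ ∘ G⊆F)) (σ i)))
      (increasing⇒inflationary (reindex-increasing F↑ G↑ (proj₂ ∘ F⊆G)) i)

m<n⇒[n∸[n∸m]%n]%n≡m : ∀ {m n} .{{_ : NonZero n}} → m ℕ.< n → (n ∸ (n ∸ m) % n) % n ≡ m
m<n⇒[n∸[n∸m]%n]%n≡m {zero} {n} _ = begin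
  (n ∸ (n ∸ 0) % n) % n ≡⟨ cong (λ k → (n ∸ k) % n) (n%n≡0 n) ⟩
  n % n                 ≡⟨ n%n≡0 n ⟩
  0                     ∎
  where open ≡-Reasoning
m<n⇒[n∸[n∸m]%n]%n≡m {suc m} {n} m<n = begin
  (n ∸ (n ∸ suc m) % n) % n ≡⟨ cong (λ k → (n ∸ k) % n) n∸[1+m]%n≡n∸[1+m] ⟩
  (n ∸ (n ∸ suc m)) % n     ≡⟨ cong (_% n) (ℕ.m∸[m∸n]≡n (ℕ.<⇒≤ m<n)) ⟩
  suc m % n                 ≡⟨ m<n⇒m%n≡m m<n ⟩
  suc m                     ∎
  where
  open ≡-Reasoning
  n∸[1+m]%n≡n∸[1+m] : (n ∸ suc m) % n ≡ n ∸ suc m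
  n∸[1+m]%n≡n∸[1+m] = m<n⇒m%n≡m (ℕ.∸-monoʳ-< (ℕ.s≤s ℕ.z≤n) (ℕ.<⇒≤ m<n))

module _ {r : ℕ} .{{_ : NonZero r}} where

  toℕ-mod : ∀ m → toℕ (m mod r) ≡ m % r
  toℕ-mod m = toℕ-fromℕ< _

  -ᶜ-involutive : ∀ (c : Fin r) → -ᶜ (-ᶜ c) ≡ c
  -ᶜ-involutive c = toℕ-injective (begin
    toℕ (-ᶜ (-ᶜ c))                     ≡⟨ toℕ-mod _ ⟩
    (r ∸ toℕ (-ᶜ c)) % r                ≡⟨ cong (λ k → (r ∸ k) % r) (toℕ-mod _) ⟩
    (r ∸ (r ∸ toℕ c) % r) % r           ≡⟨ m<n⇒[n∸[n∸m]%n]%n≡m (toℕ<n c) ⟩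
    toℕ c                               ∎)
    where open ≡-Reasoning

  -ᶜ-injective : ∀ {c d : Fin r} → -ᶜ c ≡ -ᶜ d → c ≡ d
  -ᶜ-injective {c} {d} -c≡-d = begin
    c          ≡⟨ -ᶜ-involutive c ⟨
    -ᶜ (-ᶜ c)  ≡⟨ cong -ᶜ_ -c≡-d ⟩
    -ᶜ (-ᶜ d)  ≡⟨ -ᶜ-involutive d ⟩
    d          ∎
    where open ≡-Reasoning

  toℕ-zeroᶜ : toℕ (zeroᶜ {r}) ≡ 0
  toℕ-zeroᶜ = trans (toℕ-mod 0) (m<n⇒m%n≡m (ℕ.>-nonZero⁻¹ r))

  +ᶜ-identityʳ : ∀ (c : Fin r) → c +ᶜ zeroᶜ ≡ c
  +ᶜ-identityʳ c = toℕ-injective (begin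
    toℕ (c +ᶜ zeroᶜ)          ≡⟨ toℕ-mod _ ⟩
    (toℕ c + toℕ zeroᶜ) % r   ≡⟨ cong (λ k → (toℕ c + k) % r) toℕ-zeroᶜ ⟩
    (toℕ c + 0) % r           ≡⟨ cong (_% r) (ℕ.+-identityʳ (toℕ c)) ⟩
    toℕ c % r                 ≡⟨ m<n⇒m%n≡m (toℕ<n c) ⟩
    toℕ c                     ∎)
    where open ≡-Reasoning

_≈ᵖ_ : ∀ {r n} → Rel (Fin n × Fin r) 0ℓ
_≈ᵖ_ = Pointwise _≡_ _≡_ on swap

-- _<ᵖ_ is, definitionally, the lexicographic order on (colour, value) with colours reversed.
<ᵖ-isStrictTotalOrder : ∀ {r n} → IsStrictTotalOrder (_≈ᵖ_ {r} {n}) _<ᵖ_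
<ᵖ-isStrictTotalOrder = On.isStrictTotalOrder swap
  (×-isStrictTotalOrder (Flip.isStrictTotalOrder <-isStrictTotalOrder) <-isStrictTotalOrder)

open module <ᵖ {r n} = IsStrictTotalOrder (<ᵖ-isStrictTotalOrder {r} {n})
  using () renaming (isStrictPartialOrder to <ᵖ-isStrictPartialOrder; compare to <ᵖ-compare)

perm-injective : ∀ {n} (π : Permutation′ n) {i j} → π ⟨$⟩ʳ i ≡ π ⟨$⟩ʳ j → i ≡ j
perm-injective π {i} {j} πi≡πj = begin
  i                  ≡⟨ inverseˡ π ⟨
  π ⟨$⟩ˡ (π ⟨$⟩ʳ i)  ≡⟨ cong (π ⟨$⟩ˡ_) πi≡πj ⟩
  π ⟨$⟩ˡ (π ⟨$⟩ʳ j)  ≡⟨ inverseˡ π ⟩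
  j                  ∎
  where open ≡-Reasoning

InI⇒entry-increasing : ∀ {r n} (x : Col r n) → InI x → entry x Preserves _<_ ⟶ _<ᵖ_
InI⇒entry-increasing x x∈I = adjacent⇒increasing <ᵖ-isStrictPartialOrder ascent
  where
  ascent : ∀ i j → toℕ j ≡ suc (toℕ i) → entry x i <ᵖ entry x j
  ascent i j j≡1+i with <ᵖ-compare (entry x i) (entry x j)
  ... | tri< xi<xj _ _ = xi<xj
  ... | tri≈ _ (_ , πi≡πj) _ =
    contradiction (trans (sym j≡1+i) (cong toℕ (perm-injective (perm x) (sym πi≡πj)))) ℕ.1+n≢n
  ... | tri> _ _ xj<xi = contradiction (j≡1+i , xj<xi) (x∈I i j)

module _ {r : ℕ} .{{_ : NonZero r}} {n : ℕ} where

  NNeg-⁻¹-perm : ∀ (x : Col r n) i → NNeg (x ⁻¹) (perm x ⟨$⟩ʳ i) ≡ toℕ (-ᶜ color x i)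
  NNeg-⁻¹-perm x i = cong (λ k → toℕ (-ᶜ color x k)) (inverseˡ (perm x))

  NNeg-⁻¹-·-embed : ∀ (x : Col r n) π → NNeg ((x · embed π) ⁻¹) ≡ₘ NNeg (x ⁻¹)
  NNeg-⁻¹-·-embed x π j =
    cong (λ c → toℕ (-ᶜ c)) (trans (+ᶜ-identityʳ _) (cong (color x) (inverseʳ π)))

  NNeg-⁻¹-≡ₘ⇒entry-⊆ : ∀ (x y : Col r n) → NNeg (x ⁻¹) ≡ₘ NNeg (y ⁻¹) →
    ∀ i → ∃[ j ] entry y j ≈ᵖ entry x i
  NNeg-⁻¹-≡ₘ⇒entry-⊆ x y x≡ₘy i = j , -ᶜ-injective (toℕ-injective colours) , inverseʳ (perm y)
    where
    j : Fin n
    j = perm y ⟨$⟩ˡ (perm x ⟨$⟩ʳ i)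

    colours : toℕ (-ᶜ color y j) ≡ toℕ (-ᶜ color x i)
    colours = begin
      toℕ (-ᶜ color y j)            ≡⟨ NNeg-⁻¹-perm y j ⟨
      NNeg (y ⁻¹) (perm y ⟨$⟩ʳ j)   ≡⟨ cong (NNeg (y ⁻¹)) (inverseʳ (perm y)) ⟩
      NNeg (y ⁻¹) (perm x ⟨$⟩ʳ i)   ≡⟨ x≡ₘy (perm x ⟨$⟩ʳ i) ⟨
      NNeg (x ⁻¹) (perm x ⟨$⟩ʳ i)   ≡⟨ NNeg-⁻¹-perm x i ⟩
      toℕ (-ᶜ color x i)            ∎
      where open ≡-Reasoning

  InI-NNeg-⁻¹-injective : ∀ (x y : Col r n) → InI x → InI y → NNeg (x ⁻¹) ≡ₘ NNeg (y ⁻¹) → x ≈ᶜ y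
  InI-NNeg-⁻¹-injective x y x∈I y∈I x≡ₘy = proj₂ ∘ entries , proj₁ ∘ entries
    where
    entries : ∀ i → entry x i ≈ᵖ entry y i
    entries = increasing-unique <ᵖ-isStrictPartialOrder
      (InI⇒entry-increasing x x∈I) (InI⇒entry-increasing y y∈I)
      (NNeg-⁻¹-≡ₘ⇒entry-⊆ x y x≡ₘy) (NNeg-⁻¹-≡ₘ⇒entry-⊆ y x (sym ∘ x≡ₘy))

proposition5p11 : (r n : ℕ) → .{{_ : NonZero r}} → .{{_ : NonZero n}} →
    ((x : Col r n) → InI x → (π : Permutation′ n) →
      NNeg ((x · embed π) ⁻¹) ≡ₘ NNeg (x ⁻¹))
    × ((x y : Col r n) → InI x → InI y → NNeg (x ⁻¹) ≡ₘ NNeg (y ⁻¹) → x ≈ᶜ y)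
proposition5p11 r n = (λ x _ → NNeg-⁻¹-·-embed x) , InI-NNeg-⁻¹-injective
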